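{- Let $(d,Q,E)$ be a VASS, let $C,C'\subseteq\{1,\dots,d\}$, let $\bar C=\{1,\dots,d\}\setminus C$ and $\bar C'=\{1,\dots,d\}\setminus C'$, and let $q,q'\in Q$, $v\in\mathbb{N}^C$, $v'\in\mathbb{N}^{C'}$. Suppose that ($\Theta_1$) for every $m\geq 1$ there are vectors $\bar v\in\{m,m+1,\dots\}^{\bar C}$ and $\bar v'\in\{m,m+1,\dots\}^{\bar C'}$ and a pseudo-run from $(q,v\oplus\bar v)$ to $(q',v'\oplus\bar v')$ that traverses every arc of $E$ at least $m$ times; and ($\Theta_2$) there are vectors $\Delta\in\{1,2,\dots\}^C$, $\Delta'\in\{1,2,\dots\}^{C'}$, $\bar\Delta\in\mathbb{Z}^{\bar C}$, $\bar\Delta'\in\mathbb{Z}^{\bar C'}$ such that there is a $C$-run from $(q,v\oplus\vec 0)$ to $(q,(v+\Delta)\oplus\bar\Delta)$ and a $C'$-run from $(q',(v'+\Delta')\oplus\bar\Delta')$ to $(q',v'\oplus\vec 0)$. Then there are vectors $\bar v\in\mathbb{N}^{\bar C}$ and $\bar v'\in\mathbb{N}^{\bar C'}$ such that there is a run from $(q,v\oplus\bar v)$ to $(q',v'\oplus\bar v')$.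
   Context: A VASS of dimension $d\geq 1$ is a finite set $Q$ of control states and a finite set $E\subseteq Q\times\mathbb{Z}^d\times Q$ of arcs. Vectors in $\mathbb{Z}^d$ are identified with vectors in $\mathbb{Z}^{\{1,\dots,d\}}$. An arc $e=(p,z,p')$ induces a step from $(p,w)$ to $(p',w+z)$ for $w\in\mathbb{Z}^d$. A pseudo-run from $(p,w)$ to $(p',w')$ is a finite sequence of steps leading from $(p,w)$ to $(p',w')$; it is a run if all its vectors lie in $\mathbb{N}^d$, and for $C\subseteq\{1,\dots,d\}$ it is a $C$-run if all its vectors are nonnegative on every coordinate in $C$. For disjoint $C,B\subseteq\{1,\dots,d\}$ and $v\in\mathbb{Z}^C$, $w\in\mathbb{Z}^B$, $v\oplus w\in\mathbb{Z}^{C\cup B}$ denotes the vector equal to $v(i)$ for $i\in C$ and to $w(i)$ for $i\in B$. $\vec 0$ denotes the zero vector of the appropriate index set. -}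

module Defs where

open import Data.Nat as ℕ using (ℕ; suc)
open import Data.Integer as ℤ using (ℤ; +_; 0ℤ)
open import Data.Fin using (Fin; _≟_)
open import Data.Bool using (Bool; true; false; if_then_else_)
open import Data.List using (List; []; _∷_; filter; length)
open import Data.Product using (_×_; _,_; proj₁; proj₂)
open import Data.Unit using (⊤)
open import Relation.Binary.PropositionalEquality using (_≡_)
open import Function.Definitions using (Injective)

-- Vectors in ℤ^d are functions Fin d → ℤ (coordinates 1..d ↦ Fin d).
Vecℤ : ℕ → Set
Vecℤ d = Fin d → ℤ

-- A VASS of dimension d: control states Q = Fin nQ, arcs E = {arc e | e : Fin nE},
-- where arc is injective (E is a *set* of arcs; arcs are named by indices).
record VASS (d : ℕ) : Set where
  field
    nQ    : ℕ
    nE    : ℕ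
    arc   : Fin nE → Fin nQ × Vecℤ d × Fin nQ
    arc-injective : Injective _≡_ _≡_ arc

  Q : Set
  Q = Fin nQ

  src : Fin nE → Q
  src e = proj₁ (arc e)

  disp : Fin nE → Vecℤ d
  disp e = proj₁ (proj₂ (arc e))

  tgt : Fin nE → Q
  tgt e = proj₂ (proj₂ (arc e))

  data PathP (P : Vecℤ d → Set) : Q → Vecℤ d → Q → Vecℤ d → List (Fin nE) → Set where
    done : ∀ {p w w'} → P w → (∀ i → w i ≡ w' i) → PathP P p w p w' []
    step : ∀ {p w p' w' es} (e : Fin nE) → src e ≡ p → P w →
           PathP P (tgt e) (λ i → w i ℤ.+ disp e i) p' w' es →
           PathP P p w p' w' (e ∷ es)

  PseudoRun : Q → Vecℤ d → Q → Vecℤ d → List (Fin nE) → Set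
  PseudoRun = PathP (λ _ → ⊤)

  CRun : (Fin d → Bool) → Q → Vecℤ d → Q → Vecℤ d → List (Fin nE) → Set
  CRun C = PathP (λ w → ∀ i → C i ≡ true → 0ℤ ℤ.≤ w i)

  Run : Q → Vecℤ d → Q → Vecℤ d → List (Fin nE) → Set
  Run = PathP (λ w → ∀ i → 0ℤ ℤ.≤ w i)

  times : Fin nE → List (Fin nE) → ℕ
  times e es = length (filter (e ≟_) es)

-- Subsets C ⊆ {1..d} as characteristic functions.
-- v ⊕[ C ] w : equal to v on C and to w on the complement of C.
-- (A vector in ℤ^C is represented by a full vector whose values outside C are ignored.)
_⊕[_]_ : ∀ {d} → Vecℤ d → (Fin d → Bool) → Vecℤ d → Vecℤ d
(v ⊕[ C ] w) i = if C i then v i else w i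

ι : ∀ {d} → (Fin d → ℕ) → Vecℤ d
ι v i = + v i

𝟎 : ∀ {d} → Vecℤ d
𝟎 _ = 0ℤ

module Submission where

-- Θ₁ with m = 1 yields a pseudo-run A from (q, v ⊕ x) to (q', v' ⊕ x'); with
-- the C-run ρ₁ and the C'-run ρ₂ of Θ₂ it forms a walk R = ρ₁ A ρ₂ from q to q'.
-- Θ₁ for a large threshold m yields a second pseudo-run B using every arc
-- more often than R, with large values outside C and C'.  By an Euler-type
-- argument B is, as a multiset of arcs, R plus a closed walk θ at q.  For k
-- large the walk ρ₁ᵏ θᵏ A ρ₂ᵏ is a run from the extrapolation a + k⋅(b − a)
-- of the start vectors a of A and b of B to the extrapolation of their end
-- vectors.  Coordinatewise this is a one-dimensional fact (the interpolation
-- lemma): the counter climbs with slope ≥ 1 through ρ₁ᵏ (by Δ ≥ 1 on C, by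
-- b ≫ a off C), crosses θᵏ and A at height ≥ k, and descends through ρ₂ᵏ.

open import Data.Nat as Nat using (ℕ; zero; suc; z≤n; s≤s; _⊔_)
import Data.Nat.Properties as ℕₚ
open import Data.Nat.ListAction using (sum)
open import Data.Nat.ListAction.Properties using (sum-++)
open import Data.Nat.Induction using (<-wellFounded)
open import Data.Integer as Int using (ℤ; +_; -[1+_]; 0ℤ; ∣_∣; +≤+; -≤+)
import Data.Integer.Properties as ℤₚ
open import Data.Integer.Tactic.RingSolver using (solve-∀)
open import Data.Bool using (Bool; true; false)
open import Data.Fin using (Fin)
import Data.Fin as Fin
open import Data.Product using (Σ; _×_; _,_; proj₁; proj₂)
open import Data.Sum using (_⊎_; inj₁; inj₂)
open import Data.Empty using (⊥-elim)
open import Data.List using (List; []; _∷_; _++_; [_]; map; foldr; filter; length; tabulate)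
import Data.List.Properties as Listₚ
open import Data.List.Extrema.Nat using (max; xs≤max)
import Data.List.Relation.Unary.All as All
open import Data.List.Relation.Unary.Any using (Any; here; there; any?)
open import Data.List.Membership.Propositional using (_∈_; find; lose)
open import Data.List.Membership.Propositional.Properties
  using (∈-∃++; ∈-++⁻; ∈-++⁺ˡ; ∈-++⁺ʳ; ∈-map⁻; ∈-tabulate⁺)
open import Data.List.Relation.Binary.Permutation.Propositional
  using (_↭_; ↭⇒↭ₛ; prep; ↭-refl; ↭-sym; ↭-trans; module PermutationReasoning)
open import Data.List.Relation.Binary.Permutation.Propositional.Properties
  using (map⁺; filter-↭; ↭-length; ∈-resp-↭; shift; drop-∷; ∷↭∷ʳ; ++⁺ˡ; ++⁺ʳ; ++-comm; ++-identityʳ)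
open import Induction.WellFounded using (Acc; acc)
open import Relation.Nullary using (yes; no)
open import Relation.Binary.Definitions using (DecidableEquality)
open import Relation.Binary.PropositionalEquality
  using (_≡_; refl; sym; trans; cong; subst; subst₂; setoid; module ≡-Reasoning)

open import Defs

repeat : {A : Set} → ℕ → List A → List A
repeat zero    xs = []
repeat (suc k) xs = xs ++ repeat k xs

module IntegerFacts where
  open Int using (_+_; _-_; _*_; -_; _≤_)

  -∣z∣≤z : ∀ z → - + ∣ z ∣ ≤ z
  -∣z∣≤z (+ n)    = ℤₚ.neg-≤-pos
  -∣z∣≤z -[1+ n ] = ℤₚ.≤-refl

  ≤-+-nonneg : ∀ {x t} → 0ℤ ≤ t → x ≤ x + t
  ≤-+-nonneg {x} {t} 0≤t = subst (_≤ x + t) (ℤₚ.+-identityʳ x) (ℤₚ.+-monoʳ-≤ x 0≤t)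

  between : ∀ {B} x t k → B ≤ x → B ≤ x + + suc k * t → B ≤ x + t
  between x (+ n)    k B≤x _ = ℤₚ.≤-trans B≤x (≤-+-nonneg (+≤+ z≤n))
  between x -[1+ n ] k _ B≤end = ℤₚ.≤-trans B≤end (ℤₚ.+-monoʳ-≤ x (begin
      + suc k * t      ≡⟨ ℤₚ.suc-* (+ k) t ⟩
      t + + k * t      ≤⟨ ℤₚ.+-monoʳ-≤ t kt≤0 ⟩
      t + 0ℤ           ≡⟨ ℤₚ.+-identityʳ t ⟩
      t                ∎))
    where
      open ℤₚ.≤-Reasoning
      t = -[1+ n ]
      kt≤0 : + k * t ≤ 0ℤ
      kt≤0 = subst (+ k * t ≤_) (ℤₚ.*-zeroʳ (+ k)) (ℤₚ.*-monoˡ-≤-nonNeg (+ k) -≤+)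

  k≤a+kγ : ∀ k {a γ} → 0ℤ ≤ a → + 1 ≤ γ → + k ≤ a + + k * γ
  k≤a+kγ k {a} {γ} 0≤a 1≤γ =
    ℤₚ.+-mono-≤ 0≤a (subst (_≤ + k * γ) (ℤₚ.*-identityʳ (+ k)) (ℤₚ.*-monoˡ-≤-nonNeg (+ k) 1≤γ))

  effect-of : ∀ {x t y} → x + t ≡ y → t ≡ y - x
  effect-of {x} {t} x+t≡y = trans (cancel x t) (cong (_- x) x+t≡y)
    where
      cancel : ∀ x t → t ≡ (x + t) - x
      cancel = solve-∀

  gap : ∀ {m n} z → m Nat.+ ∣ z ∣ Nat.< n → + 1 ≤ + n - + m × + 1 ≤ (+ n - + m) + z
  gap {m} {n} z m+∣z∣<n =
      ℤₚ.≤-trans (≤-+-nonneg (+≤+ z≤n)) 1+∣z∣≤d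
    , (begin
        + 1                         ≤⟨ ≤-+-nonneg 0≤∣z∣+z ⟩
        + 1 + (+ ∣ z ∣ + z)         ≡⟨ ℤₚ.+-assoc (+ 1) (+ ∣ z ∣) z ⟨
        (+ 1 + + ∣ z ∣) + z         ≤⟨ ℤₚ.+-monoˡ-≤ z 1+∣z∣≤d ⟩
        (+ n - + m) + z             ∎)
    where
      open ℤₚ.≤-Reasoning
      0≤∣z∣+z : 0ℤ ≤ + ∣ z ∣ + z
      0≤∣z∣+z = subst (_≤ + ∣ z ∣ + z) (ℤₚ.+-inverseʳ (+ ∣ z ∣)) (ℤₚ.+-monoʳ-≤ (+ ∣ z ∣) (-∣z∣≤z z))
      drop-m : ∀ m c → (+ 1 + (m + c)) - m ≡ + 1 + c
      drop-m = solve-∀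
      embed : + suc (m Nat.+ ∣ z ∣) ≡ + 1 + (+ m + + ∣ z ∣)
      embed = trans (ℤₚ.pos-+ 1 (m Nat.+ ∣ z ∣)) (cong (λ c → + 1 + c) (ℤₚ.pos-+ m ∣ z ∣))
      1+∣z∣≤d : + 1 + + ∣ z ∣ ≤ + n - + m
      1+∣z∣≤d = begin
        + 1 + + ∣ z ∣                       ≡⟨ drop-m (+ m) (+ ∣ z ∣) ⟨
        (+ 1 + (+ m + + ∣ z ∣)) - + m       ≡⟨ cong (_- + m) embed ⟨
        + suc (m Nat.+ ∣ z ∣) - + m         ≤⟨ ℤₚ.+-monoˡ-≤ (- + m) (+≤+ m+∣z∣<n) ⟩
        + n - + m                           ∎

open IntegerFacts

upper : ∀ {n} → (Fin n → ℕ) → ℕ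
upper f = max 0 (tabulate f)

≤-upper : ∀ {n} (f : Fin n → ℕ) i → f i Nat.≤ upper f
≤-upper f i = All.lookup (xs≤max 0 (tabulate f)) (∈-tabulate⁺ i)

extrapolate : ∀ {d} → ℕ → Vecℤ d → Vecℤ d → Vecℤ d
extrapolate k a b i = a i Int.+ + k Int.* (b i Int.- a i)

extrapolate-⊕ : ∀ {d} k (C : Fin d → Bool) (v x y : Fin d → ℕ) i →
                let s = extrapolate k (ι v ⊕[ C ] ι x) (ι v ⊕[ C ] ι y) in
                0ℤ Int.≤ s i → (ι v ⊕[ C ] ι (λ j → ∣ s j ∣)) i ≡ s i
extrapolate-⊕ k C v x y i 0≤s with C i | 0≤s
... | true  | _    = sym (flat (+ v i) (+ k))
  where
    open Int using (_+_; _-_; _*_)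
    flat : ∀ a K → a + K * (a - a) ≡ a
    flat = solve-∀
... | false | 0≤s′ = ℤₚ.0≤i⇒+∣i∣≡i 0≤s′

-- One coordinate of a VASS along a sequence of steps: every step a : A
-- changes the counter by w a.  A sequence is *safe* from x if the counter
-- stays nonnegative at every visited position.
module Counter {A : Set} (w : A → ℤ) where
  open Int using (_+_; _-_; _*_; -_; _≤_)
  open import Data.List.Relation.Binary.Permutation.Setoid.Properties (setoid ℤ) using (foldr-commMonoid)

  total : List A → ℤ
  total xs = foldr _+_ 0ℤ (map w xs)

  total-++ : ∀ xs ys → total (xs ++ ys) ≡ total xs + total ys
  total-++ []       ys = sym (ℤₚ.+-identityˡ (total ys))
  total-++ (x ∷ xs) ys = begin
    w x + total (xs ++ ys)         ≡⟨ cong (λ t → w x + t) (total-++ xs ys) ⟩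
    w x + (total xs + total ys)    ≡⟨ ℤₚ.+-assoc (w x) _ _ ⟨
    (w x + total xs) + total ys    ∎
    where open ≡-Reasoning

  total-↭ : ∀ {xs ys} → xs ↭ ys → total xs ≡ total ys
  total-↭ p = foldr-commMonoid ℤₚ.+-0-isCommutativeMonoid (↭⇒↭ₛ (map⁺ w p))

  total-repeat : ∀ k xs → total (repeat k xs) ≡ + k * total xs
  total-repeat zero    xs = sym (ℤₚ.*-zeroˡ (total xs))
  total-repeat (suc k) xs = begin
    total (xs ++ repeat k xs)        ≡⟨ total-++ xs (repeat k xs) ⟩
    total xs + total (repeat k xs)   ≡⟨ cong (λ t → total xs + t) (total-repeat k xs) ⟩
    total xs + + k * total xs        ≡⟨ sym (ℤₚ.suc-* (+ k) (total xs)) ⟩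
    + suc k * total xs               ∎
    where open ≡-Reasoning

  -- sum of the absolute values of the steps: an upper bound on how far
  -- the counter can move below its starting value
  norm : List A → ℕ
  norm xs = sum (map (λ a → ∣ w a ∣) xs)

  norm-++ : ∀ xs ys → norm (xs ++ ys) ≡ norm xs Nat.+ norm ys
  norm-++ xs ys = trans (cong sum (Listₚ.map-++ (λ a → ∣ w a ∣) xs ys)) (sum-++ (map _ xs) _)

  norm-++ˡ : ∀ xs ys → norm xs Nat.≤ norm (xs ++ ys)
  norm-++ˡ xs ys = subst (norm xs Nat.≤_) (sym (norm-++ xs ys)) (ℕₚ.m≤m+n _ _)

  norm-++ʳ : ∀ xs ys → norm ys Nat.≤ norm (xs ++ ys)
  norm-++ʳ xs ys = subst (norm ys Nat.≤_) (sym (norm-++ xs ys)) (ℕₚ.m≤n+m _ _)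

  Safe : ℤ → List A → Set
  Safe x []       = 0ℤ ≤ x
  Safe x (a ∷ as) = 0ℤ ≤ x × Safe (x + w a) as

  Safe-start : ∀ {x} xs → Safe x xs → 0ℤ ≤ x
  Safe-start []      s       = s
  Safe-start (_ ∷ _) (s , _) = s

  Safe-end : ∀ {x} xs → Safe x xs → 0ℤ ≤ x + total xs
  Safe-end {x} []       s       = subst (0ℤ ≤_) (sym (ℤₚ.+-identityʳ x)) s
  Safe-end {x} (a ∷ as) (_ , r) = subst (0ℤ ≤_) (ℤₚ.+-assoc x (w a) (total as)) (Safe-end as r)

  Safe-++ : ∀ {x} xs {ys} → Safe x xs → Safe (x + total xs) ys → Safe x (xs ++ ys)
  Safe-++ {x} []       {ys} _       s' = subst (λ y → Safe y ys) (ℤₚ.+-identityʳ x) s'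
  Safe-++ {x} (a ∷ as) {ys} (s , r) s' =
    s , Safe-++ as r (subst (λ y → Safe y ys) (sym (ℤₚ.+-assoc x (w a) (total as))) s')

  Safe-mono : ∀ {x y} xs → x ≤ y → Safe x xs → Safe y xs
  Safe-mono []       x≤y s       = ℤₚ.≤-trans s x≤y
  Safe-mono (a ∷ as) x≤y (s , r) = ℤₚ.≤-trans s x≤y , Safe-mono as (ℤₚ.+-monoˡ-≤ (w a) x≤y) r

  Safe-large : ∀ {x} xs → + norm xs ≤ x → Safe x xs
  Safe-large []       norm≤x = norm≤x
  Safe-large {x} (a ∷ as) norm≤x = ℤₚ.≤-trans (+≤+ z≤n) norm≤x , Safe-large as (begin
      + norm as                                  ≡⟨ lemma (+ ∣ w a ∣) (+ norm as) ⟩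
      (+ ∣ w a ∣ + + norm as) + - + ∣ w a ∣      ≡⟨ cong (_+ - + ∣ w a ∣) (ℤₚ.pos-+ ∣ w a ∣ (norm as)) ⟨
      + norm (a ∷ as) + - + ∣ w a ∣              ≤⟨ ℤₚ.+-mono-≤ norm≤x (-∣z∣≤z (w a)) ⟩
      x + w a                                    ∎)
    where
      open ℤₚ.≤-Reasoning
      lemma : ∀ m n → n ≡ (m + n) + - m
      lemma = solve-∀

  -- Pumping a sequence whose norm stays below both endpoints of the pumped
  -- run: by convexity every intermediate start value is large enough.
  Safe-repeat-between : ∀ xs k {x} → + norm xs ≤ x → + norm xs ≤ x + + k * total xs →
                        Safe x (repeat k xs)
  Safe-repeat-between xs zero    norm≤x _ = ℤₚ.≤-trans (+≤+ z≤n) norm≤x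
  Safe-repeat-between xs (suc k) {x} norm≤x norm≤end =
    Safe-++ xs (Safe-large xs norm≤x)
      (Safe-repeat-between xs k (between x (total xs) k norm≤x norm≤end)
        (subst (+ norm xs ≤_) (regroup x (total xs) (+ k)) norm≤end))
    where
      regroup : ∀ x t k → x + (+ 1 + k) * t ≡ (x + t) + k * t
      regroup = solve-∀

  Safe-repeat-up : ∀ xs k {x} → Safe x xs → 0ℤ ≤ total xs → Safe x (repeat k xs)
  Safe-repeat-up xs zero    s _    = Safe-start xs s
  Safe-repeat-up xs (suc k) s 0≤t =
    Safe-++ xs s (Safe-repeat-up xs k (Safe-mono xs (≤-+-nonneg 0≤t) s) 0≤t)

  Safe-repeat-down : ∀ xs k {y u} → Safe (y + u) xs → total xs ≡ - u → 0ℤ ≤ u → 0ℤ ≤ y →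
                     Safe (y + + k * u) (repeat k xs)
  Safe-repeat-down xs zero {y} {u} _ _ _ 0≤y =
    subst (0ℤ ≤_) (sym (trans (cong (λ z → y + z) (ℤₚ.*-zeroˡ u)) (ℤₚ.+-identityʳ y))) 0≤y
  Safe-repeat-down xs (suc k) {y} {u} s t≡-u 0≤u 0≤y =
    Safe-++ xs (Safe-mono xs lift s)
      (subst (λ z → Safe z (repeat k xs)) descend (Safe-repeat-down xs k s t≡-u 0≤u 0≤y))
    where
      regroup : ∀ y u k → y + (+ 1 + k) * u ≡ (y + u) + k * u
      regroup = solve-∀
      cancel : ∀ y u k → y + k * u ≡ (y + (+ 1 + k) * u) + - u
      cancel = solve-∀
      lift : y + u ≤ y + + suc k * u
      lift = subst (y + u ≤_) (sym (regroup y u (+ k)))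
               (≤-+-nonneg (subst (_≤ + k * u) (ℤₚ.*-zeroʳ (+ k)) (ℤₚ.*-monoˡ-≤-nonNeg (+ k) 0≤u)))
      descend : y + + k * u ≡ (y + + suc k * u) + total xs
      descend = trans (cancel y u (+ k)) (cong (λ z → (y + + suc k * u) + z) (sym t≡-u))

  Leg : ℤ → List A → ℤ → Set
  Leg x xs y = Safe x xs × x + total xs ≡ y

  Leg-start : ∀ {x xs y} → Leg x xs y → 0ℤ ≤ x
  Leg-start {xs = xs} (s , _) = Safe-start xs s

  Leg-end : ∀ {x xs y} → Leg x xs y → 0ℤ ≤ y
  Leg-end {xs = xs} (s , end≡) = subst (0ℤ ≤_) end≡ (Safe-end xs s)

  _▸_ : ∀ {x y z xs ys} → Leg x xs y → Leg y ys z → Leg x (xs ++ ys) z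
  _▸_ {x} {y} {z} {xs} {ys} (s , x+t≡y) (s' , y+t'≡z) =
    Safe-++ xs s (subst (λ v → Safe v ys) (sym x+t≡y) s') , (begin
      x + total (xs ++ ys)           ≡⟨ cong (λ t → x + t) (total-++ xs ys) ⟩
      x + (total xs + total ys)      ≡⟨ ℤₚ.+-assoc x _ _ ⟨
      (x + total xs) + total ys      ≡⟨ cong (_+ total ys) x+t≡y ⟩
      y + total ys                   ≡⟨ y+t'≡z ⟩
      z                              ∎)
    where open ≡-Reasoning

  repeat-end : ∀ k x xs → x + total (repeat k xs) ≡ x + + k * total xs
  repeat-end k x xs = cong (λ t → x + t) (total-repeat k xs)

  -- The first part of the pumped run.  With a, b the values of this
  -- coordinate at the start of two pseudo-runs, the pumped run starts at
  -- a + k⋅(b − a) and traverses xs k times; this must be safe and leave the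
  -- counter growing with slope (b − a) + total xs ≥ 1.
  record Entry (k : ℕ) (a b : ℤ) (xs : List A) : Set where
    field
      start-nonneg : 0ℤ ≤ a
      slope-pos    : + 1 ≤ (b - a) + total xs
      safe         : Safe (a + + k * (b - a)) (repeat k xs)

  -- The last part of the pumped run, symmetric to Entry: it ends at
  -- a + k⋅(b − a) after traversing xs k times, entered with slope
  -- (b − a) − total xs ≥ 1.
  record Exit (k : ℕ) (a b : ℤ) (xs : List A) : Set where
    field
      slope-pos  : + 1 ≤ (b - a) - total xs
      safe       : Safe (a + + k * ((b - a) - total xs)) (repeat k xs)

  entry-pumped : ∀ k {a} xs → Safe a xs → + 1 ≤ total xs → Entry k a a xs
  entry-pumped k {a} xs s 1≤t = record
    { start-nonneg = Safe-start xs s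
    ; slope-pos    = subst (+ 1 ≤_) (sym (flat-slope a (total xs))) 1≤t
    ; safe         = subst (λ x → Safe x (repeat k xs)) (sym (flat-start a (+ k)))
                       (Safe-repeat-up xs k s (ℤₚ.≤-trans (+≤+ z≤n) 1≤t))
    }
    where
      flat-slope : ∀ a t → (a - a) + t ≡ t
      flat-slope = solve-∀
      flat-start : ∀ a K → a + K * (a - a) ≡ a
      flat-start = solve-∀

  entry-large : ∀ k {a b} xs → 0ℤ ≤ a → + 1 ≤ b - a → + 1 ≤ (b - a) + total xs →
                norm xs Nat.≤ k → Entry k a b xs
  entry-large k {a} {b} xs 0≤a 1≤d 1≤slope norm≤k = record
    { start-nonneg = 0≤a
    ; slope-pos    = 1≤slope
    ; safe         = Safe-repeat-between xs k (norm≤ (k≤a+kγ k 0≤a 1≤d))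
                       (norm≤ (subst (+ k ≤_) (regroup a (b - a) (total xs) (+ k)) (k≤a+kγ k 0≤a 1≤slope)))
    }
    where
      norm≤ : ∀ {x} → + k ≤ x → + norm xs ≤ x
      norm≤ = ℤₚ.≤-trans (+≤+ norm≤k)
      regroup : ∀ a d t K → a + K * (d + t) ≡ (a + K * d) + K * t
      regroup = solve-∀

  exit-pumped : ∀ k {a} xs → Safe (a - total xs) xs → + 1 ≤ - total xs → 0ℤ ≤ a → Exit k a a xs
  exit-pumped k {a} xs s 1≤-t 0≤a = record
    { slope-pos  = subst (+ 1 ≤_) (sym (flat-slope a (total xs))) 1≤-t
    ; safe       = subst (λ x → Safe x (repeat k xs))
                     (cong (λ z → a + + k * z) (sym (flat-slope a (total xs))))
                     (Safe-repeat-down xs k s (sym (ℤₚ.neg-involutive (total xs)))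
                       (ℤₚ.≤-trans (+≤+ z≤n) 1≤-t) 0≤a)
    }
    where
      flat-slope : ∀ a t → (a - a) - t ≡ - t
      flat-slope = solve-∀

  exit-large : ∀ k {a b} xs → 0ℤ ≤ a → + 1 ≤ b - a → + 1 ≤ (b - a) - total xs →
               norm xs Nat.≤ k → Exit k a b xs
  exit-large k {a} {b} xs 0≤a 1≤d 1≤slope norm≤k = record
    { slope-pos  = 1≤slope
    ; safe       = Safe-repeat-between xs k (norm≤ (k≤a+kγ k 0≤a 1≤slope))
                     (norm≤ (subst (+ k ≤_) (regroup a (b - a) (total xs) (+ k)) (k≤a+kγ k 0≤a 1≤d)))
    }
    where
      norm≤ : ∀ {x} → + k ≤ x → + norm xs ≤ x
      norm≤ = ℤₚ.≤-trans (+≤+ norm≤k)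
      regroup : ∀ a d t K → a + K * d ≡ (a + K * (d - t)) + K * t
      regroup = solve-∀

  -- Let a, a' (resp. b, b') be the values of this
  -- coordinate at the start and end of a pseudo-run ys (resp. of a pseudo-run
  -- whose effect is that of θ, xs₁, ys and xs₂ together).
  interpolation : ∀ k {a b a' b'} xs₁ θ ys xs₂ →
    Entry k a b xs₁ → Exit k a' b' xs₂ → norm θ Nat.≤ k → norm ys Nat.≤ k →
    total ys ≡ a' - a → b' - b ≡ total θ + (total xs₁ + (total ys + total xs₂)) →
    Leg (a + + k * (b - a)) (repeat k xs₁ ++ (repeat k θ ++ (ys ++ repeat k xs₂))) (a' + + k * (b' - a'))
  interpolation k {a} {b} {a'} {b'} xs₁ θ ys xs₂ entry exit θ≤k ys≤k total-ys total-B =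
    leg₁ ▸ (leg₂ ▸ (leg₃ ▸ leg₄))
    where
      K = + k
      t₁ = total xs₁
      t₂ = total xs₂
      α = (b - a) + t₁
      β = (b' - a') - t₂
      0≤a = Entry.start-nonneg entry
      k≤a+Kβ : K ≤ a + K * β
      k≤a+Kβ = k≤a+kγ k 0≤a (Exit.slope-pos exit)
      norm≤ : ∀ {n x} → n Nat.≤ k → K ≤ x → + n ≤ x
      norm≤ n≤k = ℤₚ.≤-trans (+≤+ n≤k)

      -- the closed walk θ accounts for the difference of the slopes
      total-θ : total θ ≡ β - α
      total-θ = begin
        total θ                                      ≡⟨ cancel (total θ) (t₁ + (total ys + t₂)) ⟩
        (total θ + (t₁ + (total ys + t₂))) - (t₁ + (total ys + t₂))
                                                     ≡⟨ cong (_- (t₁ + (total ys + t₂))) (sym total-B) ⟩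
        (b' - b) - (t₁ + (total ys + t₂))            ≡⟨ cong (λ t → (b' - b) - (t₁ + (t + t₂))) total-ys ⟩
        (b' - b) - (t₁ + ((a' - a) + t₂))            ≡⟨ rearrange a b a' b' t₁ t₂ ⟩
        β - α                                        ∎
        where
          open ≡-Reasoning
          cancel : ∀ x y → x ≡ (x + y) - y
          cancel = solve-∀
          rearrange : ∀ a b a' b' t₁ t₂ → (b' - b) - (t₁ + ((a' - a) + t₂)) ≡ ((b' - a') - t₂) - ((b - a) + t₁)
          rearrange = solve-∀

      leg₁ : Leg (a + K * (b - a)) (repeat k xs₁) (a + K * α)
      leg₁ = Entry.safe entry , trans (repeat-end k (a + K * (b - a)) xs₁) (step₁ a (b - a) t₁ K)
        where
          step₁ : ∀ a d t K → (a + K * d) + K * t ≡ a + K * (d + t)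
          step₁ = solve-∀

      leg₂ : Leg (a + K * α) (repeat k θ) (a + K * β)
      leg₂ = Safe-repeat-between θ k (norm≤ θ≤k (k≤a+kγ k 0≤a (Entry.slope-pos entry)))
                                     (norm≤ θ≤k (subst (K ≤_) (sym end₂) k≤a+Kβ))
           , trans (repeat-end k (a + K * α) θ) end₂
        where
          step₂ : ∀ a α β K → (a + K * α) + K * (β - α) ≡ a + K * β
          step₂ = solve-∀
          end₂ : (a + K * α) + K * total θ ≡ a + K * β
          end₂ = trans (cong (λ t → (a + K * α) + K * t) total-θ) (step₂ a α β K)

      leg₃ : Leg (a + K * β) ys (a' + K * β)
      leg₃ = Safe-large ys (norm≤ ys≤k k≤a+Kβ)
           , trans (cong (λ t → (a + K * β) + t) total-ys) (step₃ a a' (K * β))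
        where
          step₃ : ∀ a a' m → (a + m) + (a' - a) ≡ a' + m
          step₃ = solve-∀

      leg₄ : Leg (a' + K * β) (repeat k xs₂) (a' + K * (b' - a'))
      leg₄ = Exit.safe exit , trans (repeat-end k (a' + K * β) xs₂) (step₄ a' (b' - a') t₂ K)
        where
          step₄ : ∀ a d t K → (a + K * (d - t)) + K * t ≡ a + K * d
          step₄ = solve-∀

module Graph {Q E : Set} (_≟Q_ : DecidableEquality Q) (_≟E_ : DecidableEquality E) (src tgt : E → Q) where

  data Walk : Q → Q → List E → Set where
    nil  : ∀ {p} → Walk p p []
    cons : ∀ {p p' es} (e : E) → src e ≡ p → Walk (tgt e) p' es → Walk p p' (e ∷ es)

  _++ʷ_ : ∀ {a b c xs ys} → Walk a b xs → Walk b c ys → Walk a c (xs ++ ys)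
  nil           ++ʷ w' = w'
  cons e src≡ w ++ʷ w' = cons e src≡ (w ++ʷ w')

  repeat-walk : ∀ {p xs} k → Walk p p xs → Walk p p (repeat k xs)
  repeat-walk zero    w = nil
  repeat-walk (suc k) w = w ++ʷ repeat-walk k w

  occ : E → List E → ℕ
  occ e xs = length (filter (e ≟E_) xs)

  occ-++ : ∀ e xs ys → occ e (xs ++ ys) ≡ occ e xs Nat.+ occ e ys
  occ-++ e xs ys = trans (cong length (Listₚ.filter-++ (e ≟E_) xs ys)) (Listₚ.length-++ (filter (e ≟E_) xs))

  occ-↭ : ∀ e {xs ys} → xs ↭ ys → occ e xs ≡ occ e ys
  occ-↭ e p = ↭-length (filter-↭ (e ≟E_) p)

  occ-pos⇒∈ : ∀ e xs → 1 Nat.≤ occ e xs → e ∈ xs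
  occ-pos⇒∈ e (x ∷ xs) pos with e ≟E x
  ... | yes refl = here refl
  ... | no _     = there (occ-pos⇒∈ e xs pos)

  extract : ∀ {x L} → x ∈ L → Σ (List E) λ L₁ → L ↭ x ∷ L₁
  extract {x} x∈L with ∈-∃++ x∈L
  ... | ys , zs , refl = ys ++ zs , shift x ys zs

  difference : ∀ R W → (∀ e → occ e R Nat.≤ occ e W) → Σ (List E) λ L → W ↭ L ++ R
  difference []      W _    = W , ↭-sym (++-identityʳ W)
  difference (r ∷ R) W occ≤ with extract (occ-pos⇒∈ r W (ℕₚ.≤-trans (occ-self r R) (occ≤ r)))
    where
      occ-self : ∀ r R → 1 Nat.≤ occ r (r ∷ R)
      occ-self r R with r ≟E r
      ... | yes _  = s≤s z≤n
      ... | no r≢r = ⊥-elim (r≢r refl)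
  ... | W₁ , W↭ with difference R W₁ (λ e → ℕₚ.+-cancelˡ-≤ (occ e [ r ]) _ _
                       (subst₂ Nat._≤_ (occ-++ e [ r ] R) (trans (occ-↭ e W↭) (occ-++ e [ r ] W₁)) (occ≤ e)))
  ... | L , W₁↭ = L , ↭-trans W↭ (↭-trans (prep r W₁↭) (↭-sym (shift r L R)))

  -- L has the in/out-degree profile of a walk from a to b: the departure
  -- vertices of L together with b are a permutation of the arrival vertices
  -- together with a.
  Trail : Q → Q → List E → Set
  Trail a b L = a ∷ map tgt L ↭ map src L ++ [ b ]

  Balanced : List E → Set
  Balanced L = map tgt L ↭ map src L

  walk-trail : ∀ {a b xs} → Walk a b xs → Trail a b xs
  walk-trail nil             = ↭-refl
  walk-trail (cons e refl w) = prep (src e) (walk-trail w)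

  -- Greedy trail extraction: a multiset of arcs with the degree profile of
  -- a walk from a to b contains such a walk P, and the rest is balanced.
  -- (Follow arcs leaving the current vertex until none is left; the degree
  -- profile forces this to happen exactly at b.)
  trail-split : ∀ {a b} L → Acc Nat._<_ (length L) → Trail a b L →
                Σ (List E) λ P → Σ (List E) λ L₂ → Walk a b P × L ↭ P ++ L₂ × Balanced L₂
  trail-split {a} {b} L (acc shorter) trail with any? (λ x → src x ≟Q a) L
  ... | yes leaves-a with find leaves-a
  ...   | x , x∈L , src≡a with extract x∈L
  ...     | L₁ , L↭ with trail-split L₁ (shorter (ℕₚ.≤-reflexive (sym (↭-length L↭)))) trail₁
    where
      open PermutationReasoning
      trail₁ : Trail (tgt x) b L₁
      trail₁ = drop-∷ (begin
        a ∷ tgt x ∷ map tgt L₁           ↭⟨ prep a (map⁺ tgt (↭-sym L↭)) ⟩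
        a ∷ map tgt L                    ↭⟨ trail ⟩
        map src L ++ [ b ]               ↭⟨ ++⁺ʳ [ b ] (map⁺ src L↭) ⟩
        src x ∷ map src L₁ ++ [ b ]      ≡⟨ cong (λ p → p ∷ map src L₁ ++ [ b ]) src≡a ⟩
        a ∷ map src L₁ ++ [ b ]          ∎)
  ...       | P , L₂ , walk-P , L₁↭ , balanced =
    x ∷ P , L₂ , cons x src≡a walk-P , ↭-trans L↭ (prep x L₁↭) , balanced
  trail-split {a} {b} L _ trail | no stuck = [] , L , subst (λ v → Walk a v []) a≡b nil , ↭-refl , balanced
    where
      a≡b : a ≡ b
      a≡b with ∈-++⁻ (map src L) (∈-resp-↭ trail (here refl))
      ... | inj₁ a∈srcs with ∈-map⁻ src a∈srcs
      ...   | x , x∈L , a≡src = ⊥-elim (stuck (lose x∈L (sym a≡src)))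
      a≡b | inj₂ (here a≡b) = a≡b
      balanced : Balanced L
      balanced = drop-∷ (↭-trans trail
        (subst (λ v → map src L ++ [ v ] ↭ a ∷ map src L) a≡b (↭-sym (∷↭∷ʳ a (map src L)))))

  record Visits (a b : Q) (T : List E) (p : Q) : Set where
    field
      before after : List E
      split        : T ≡ before ++ after
      walk-before  : Walk a p before
      walk-after   : Walk p b after

  visits-start : ∀ {a b T} → Walk a b T → Visits a b T a
  visits-start {T = T} w = record { before = [] ; after = T ; split = refl ; walk-before = nil ; walk-after = w }

  visits-tgt : ∀ {a b T x} → Walk a b T → x ∈ T → Visits a b T (tgt x)
  visits-tgt (cons y src≡ w) (here refl) =
    record { before = [ y ] ; after = _ ; split = refl ; walk-before = cons y src≡ nil ; walk-after = w }
  visits-tgt (cons y src≡ w) (there x∈T) = record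
    { before      = y ∷ Visits.before v
    ; after       = Visits.after v
    ; split       = cong (y ∷_) (Visits.split v)
    ; walk-before = cons y src≡ (Visits.walk-before v)
    ; walk-after  = Visits.walk-after v
    }
    where v = visits-tgt w x∈T

  find-entry : ∀ {a T L c d W} → Walk a a T → Walk c d W → Visits a a T c →
               (∀ {x} → x ∈ W → x ∈ T ⊎ x ∈ L) → Any (_∈ L) W →
               Σ E λ x → x ∈ L × Visits a a T (src x)
  find-entry walk-T (cons x refl w) visits cover (here x∈L) = x , x∈L , visits
  find-entry walk-T (cons x refl w) visits cover (there some) with cover (here refl)
  ... | inj₂ x∈L = x , x∈L , visits
  ... | inj₁ x∈T = find-entry walk-T w (visits-tgt walk-T x∈T) (λ m → cover (there m)) some

  balanced-open : ∀ {L x L₁} → Balanced L → L ↭ x ∷ L₁ → Trail (tgt x) (src x) L₁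
  balanced-open {L} {x} {L₁} balanced L↭ = begin
    tgt x ∷ map tgt L₁        ↭⟨ map⁺ tgt (↭-sym L↭) ⟩
    map tgt L                 ↭⟨ balanced ⟩
    map src L                 ↭⟨ map⁺ src L↭ ⟩
    src x ∷ map src L₁        ↭⟨ ∷↭∷ʳ (src x) (map src L₁) ⟩
    map src L₁ ++ [ src x ]   ∎
    where open PermutationReasoning

  splice : ∀ {a T x P} → Visits a a T (src x) → Walk (tgt x) (src x) P →
           Σ (List E) λ T' → Walk a a T' × T' ↭ T ++ (x ∷ P)
  splice {x = x} {P}
    record { before = T₁ ; after = T₂ ; split = refl ; walk-before = w₁ ; walk-after = w₂ } walk-P =
    T₁ ++ ((x ∷ P) ++ T₂) , w₁ ++ʷ (cons x refl walk-P ++ʷ w₂) , (begin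
      T₁ ++ ((x ∷ P) ++ T₂)    ↭⟨ ++⁺ˡ T₁ (++-comm (x ∷ P) T₂) ⟩
      T₁ ++ (T₂ ++ (x ∷ P))    ≡⟨ Listₚ.++-assoc T₁ T₂ (x ∷ P) ⟨
      (T₁ ++ T₂) ++ (x ∷ P)    ∎)
    where open PermutationReasoning

  record Spliced (a : Q) (T L : List E) : Set where
    field
      T′ L′       : List E
      walk-T′     : Walk a a T′
      balanced-L′ : Balanced L′
      regroup     : T ++ L ↭ T′ ++ L′
      shrinks     : length L′ Nat.< length L
      L′⊆L        : ∀ {z} → z ∈ L′ → z ∈ L

  splice-step : ∀ {a T L x} → Balanced L → x ∈ L → Visits a a T (src x) → Spliced a T L
  splice-step {T = T} {L} {x} balanced x∈L visits
    with extract x∈L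
  ... | L₁ , L↭ with trail-split L₁ (<-wellFounded _) (balanced-open balanced L↭)
  ... | P , L₂ , walk-P , L₁↭ , balanced₂ with splice visits walk-P
  ... | T′ , walk-T′ , T′↭ = record
    { T′ = T′ ; L′ = L₂ ; walk-T′ = walk-T′ ; balanced-L′ = balanced₂
    ; regroup = begin
        T ++ L                ↭⟨ ++⁺ˡ T L↭′ ⟩
        T ++ ((x ∷ P) ++ L₂)  ≡⟨ Listₚ.++-assoc T (x ∷ P) L₂ ⟨
        (T ++ (x ∷ P)) ++ L₂  ↭⟨ ++⁺ʳ L₂ (↭-sym T′↭) ⟩
        T′ ++ L₂              ∎
    ; shrinks = subst (length L₂ Nat.<_) (sym (trans (↭-length L↭′) (cong suc (Listₚ.length-++ P))))
                  (s≤s (ℕₚ.m≤n+m (length L₂) (length P)))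
    ; L′⊆L = λ m → ∈-resp-↭ (↭-sym L↭′) (there (∈-++⁺ʳ P m))
    }
    where
      open PermutationReasoning
      L↭′ : L ↭ x ∷ P ++ L₂
      L↭′ = ↭-trans L↭ (prep x L₁↭)

  absorb : ∀ {a b W} → Walk a b W → ∀ T L → Acc Nat._<_ (length L) → Walk a a T → Balanced L →
           (∀ {x} → x ∈ W → x ∈ T ++ L) → (∀ {x} → x ∈ L → x ∈ W) →
           Σ (List E) λ T' → Walk a a T' × T ++ L ↭ T'
  absorb walk-W T [] _ walk-T _ _ _ = T , walk-T , ++-identityʳ T
  absorb walk-W T L@(y ∷ _) (acc shorter) walk-T balanced cover L⊆W
    with find-entry walk-T walk-W (visits-start walk-T) (λ m → ∈-++⁻ T (cover m))
                    (lose (L⊆W (here refl)) (here refl))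
  ... | x , x∈L , visits with splice-step balanced x∈L visits
  ... | spliced with absorb walk-W T′ L′ (shorter shrinks) walk-T′ balanced-L′
                         (λ m → ∈-resp-↭ regroup (cover m)) (λ m → L⊆W (L′⊆L m))
    where open Spliced spliced
  ... | T″ , walk-T″ , T′L′↭ = T″ , walk-T″ , ↭-trans (Spliced.regroup spliced) T′L′↭

  difference-balanced : ∀ {a b W R L} → Walk a b W → Walk a b R → W ↭ L ++ R → Balanced L
  difference-balanced {a} {b} {W} {R} {L} walk-W walk-R W↭ = cancel (a ∷ map tgt R) (begin
    (a ∷ map tgt R) ++ map tgt L        ↭⟨ prep a (++-comm (map tgt R) (map tgt L)) ⟩
    a ∷ map tgt L ++ map tgt R          ≡⟨ cong (a ∷_) (Listₚ.map-++ tgt L R) ⟨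
    a ∷ map tgt (L ++ R)                ↭⟨ prep a (map⁺ tgt (↭-sym W↭)) ⟩
    a ∷ map tgt W                       ↭⟨ walk-trail walk-W ⟩
    map src W ++ [ b ]                  ↭⟨ ++⁺ʳ [ b ] (map⁺ src W↭) ⟩
    map src (L ++ R) ++ [ b ]           ≡⟨ cong (_++ [ b ]) (Listₚ.map-++ src L R) ⟩
    (map src L ++ map src R) ++ [ b ]   ≡⟨ Listₚ.++-assoc (map src L) (map src R) [ b ] ⟩
    map src L ++ (map src R ++ [ b ])   ↭⟨ ++-comm (map src L) (map src R ++ [ b ]) ⟩
    (map src R ++ [ b ]) ++ map src L   ↭⟨ ++⁺ʳ (map src L) (↭-sym (walk-trail walk-R)) ⟩
    (a ∷ map tgt R) ++ map src L        ∎)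
    where
      open PermutationReasoning
      cancel : ∀ zs {xs ys : List Q} → zs ++ xs ↭ zs ++ ys → xs ↭ ys
      cancel []       p = p
      cancel (z ∷ zs) p = cancel zs (drop-∷ p)

  -- If W and R are walks from a to b and every
  -- arc occurs more often in W than in R, then W is a permutation of T ++ R
  -- for a closed walk T at a.  (W − R is balanced and contains every arc,
  -- so by following W it can be absorbed cycle by cycle into a closed walk.)
  euler : ∀ {a b W R} → Walk a b W → Walk a b R → (∀ e → occ e R Nat.< occ e W) →
          Σ (List E) λ T → Walk a a T × W ↭ T ++ R
  euler {W = W} {R} walk-W walk-R more with difference R W (λ e → ℕₚ.<⇒≤ (more e))
  ... | L , W↭ with absorb walk-W [] L (<-wellFounded _) nil (difference-balanced walk-W walk-R W↭)
                      (λ {x} _ → every-arc-in-L x) (λ m → ∈-resp-↭ (↭-sym W↭) (∈-++⁺ˡ m))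
    where
      positive : ∀ n {m} → m Nat.< n Nat.+ m → 1 Nat.≤ n
      positive zero    m<m = ⊥-elim (ℕₚ.<-irrefl refl m<m)
      positive (suc n) _   = s≤s z≤n
      every-arc-in-L : ∀ x → x ∈ L
      every-arc-in-L x = occ-pos⇒∈ x L (positive (occ x L)
        (subst (occ x R Nat.<_) (trans (occ-↭ x W↭) (occ-++ x L R)) (more x)))
  ... | T , walk-T , L↭T = T , walk-T , ↭-trans W↭ (++⁺ʳ R L↭T)

module VASSRuns {d : ℕ} (V : VASS d) where
  open VASS V
  open Int using (_+_)
  open Graph Fin._≟_ Fin._≟_ src tgt public

  module Coord (i : Fin d) = Counter (λ e → disp e i)
  open Coord public

  path-walk : ∀ {P p w p' w' es} → PathP P p w p' w' es → Walk p p' es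
  path-walk (done _ _)          = nil
  path-walk (step e src≡ _ rest) = cons e src≡ (path-walk rest)

  path-effect : ∀ {P p w p' w' es} → PathP P p w p' w' es → ∀ i → w i + total i es ≡ w' i
  path-effect (done _ w≡w') i = trans (ℤₚ.+-identityʳ _) (w≡w' i)
  path-effect {w = w} (step e _ _ rest) i =
    trans (sym (ℤₚ.+-assoc (w i) (disp e i) _)) (path-effect rest i)

  crun-safe : ∀ {C p w p' w' es} → CRun C p w p' w' es → ∀ i → C i ≡ true → Safe i (w i) es
  crun-safe (done ok _)       i c = ok i c
  crun-safe (step _ _ ok rest) i c = ok i c , crun-safe rest i c

  run-of : ∀ {p p' es w w'} → Walk p p' es → (∀ i → Leg i (w i) es (w' i)) → Run p w p' w' es
  run-of nil legs = done (λ i → proj₁ (legs i)) (λ i → trans (sym (ℤₚ.+-identityʳ _)) (proj₂ (legs i)))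
  run-of {w = w} (cons e src≡ walk) legs = step e src≡ (λ i → proj₁ (proj₁ (legs i)))
    (run-of walk (λ i → proj₂ (proj₁ (legs i)) , trans (ℤₚ.+-assoc (w i) (disp e i) _) (proj₂ (legs i))))

-- The pumping construction, for fixed data from hypothesis Θ₂ and a first
-- pseudo-run A from q to q' (given by Θ₁ for m = 1).
module Pumping {d : ℕ} (V : VASS d) (C C' : Fin d → Bool) (q q' : VASS.Q V) (v v' : Fin d → ℕ)
  (Δ Δ' : Fin d → ℕ) (Δb Δb' : Fin d → ℤ) (es₁ es₂ : List (Fin (VASS.nE V)))
  (Δ-pos : ∀ i → C i ≡ true → 1 Nat.≤ Δ i) (Δ'-pos : ∀ i → C' i ≡ true → 1 Nat.≤ Δ' i)
  (run₁ : VASS.CRun V C q (ι v ⊕[ C ] 𝟎) q ((λ i → + v i Int.+ + Δ i) ⊕[ C ] Δb) es₁)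
  (run₂ : VASS.CRun V C' q' ((λ i → + v' i Int.+ + Δ' i) ⊕[ C' ] Δb') q' (ι v' ⊕[ C' ] 𝟎) es₂)
  (vb₁ vb₁' : Fin d → ℕ) (esA : List (Fin (VASS.nE V)))
  (runA : VASS.PseudoRun V q (ι v ⊕[ C ] ι vb₁) q' (ι v' ⊕[ C' ] ι vb₁') esA) where

  open VASS V
  open VASSRuns V
  open Int using (_+_; _-_; -_; _≤_)

  R : List (Fin nE)
  R = es₁ ++ (esA ++ es₂)

  walk-R : Walk q q' R
  walk-R = path-walk run₁ ++ʷ (path-walk runA ++ʷ path-walk run₂)

  -- How large a second pseudo-run must be: it must use every arc more often
  -- than R does, and exceed A outside C (resp. C') by more than the effect
  -- of run₁ (resp. run₂).
  threshold : ℕ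
  threshold = suc (length R ⊔ upper (λ i → (vb₁ i Nat.+ ∣ Δb i ∣) ⊔ (vb₁' i Nat.+ ∣ Δb' i ∣)))

  R<threshold : ∀ e → occ e R Nat.< threshold
  R<threshold e = s≤s (ℕₚ.≤-trans (Listₚ.length-filter (e Fin.≟_) R) (ℕₚ.m≤m⊔n _ _))

  gaps<threshold : ∀ i → vb₁ i Nat.+ ∣ Δb i ∣ Nat.< threshold × vb₁' i Nat.+ ∣ Δb' i ∣ Nat.< threshold
  gaps<threshold i = s≤s (ℕₚ.≤-trans (ℕₚ.m≤m⊔n _ _) below-upper) , s≤s (ℕₚ.≤-trans (ℕₚ.m≤n⊔m _ _) below-upper)
    where
      below-upper = ℕₚ.≤-trans (≤-upper (λ j → (vb₁ j Nat.+ ∣ Δb j ∣) ⊔ (vb₁' j Nat.+ ∣ Δb' j ∣)) i) (ℕₚ.m≤n⊔m _ _)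

  -- Every coordinate admits an entry: by pumping run₁ on C, and by the
  -- largeness of the second pseudo-run outside C.
  entry : ∀ k (vbM : Fin d → ℕ) → (∀ i → C i ≡ false → threshold Nat.≤ vbM i) →
          ∀ i → norm i es₁ Nat.≤ k → Entry i k ((ι v ⊕[ C ] ι vb₁) i) ((ι v ⊕[ C ] ι vbM) i) es₁
  entry k vbM large i norm≤k with C i | crun-safe run₁ i | path-effect run₁ i | Δ-pos i | large i
  ... | true  | safe | effect | pos | _ =
    entry-pumped i k es₁ (safe refl) (subst (+ 1 ≤_) (sym total≡Δ) (+≤+ (pos refl)))
    where
      added : ∀ a t → (a + t) - a ≡ t
      added = solve-∀
      total≡Δ : total i es₁ ≡ + Δ i
      total≡Δ = trans (effect-of {x = + v i} effect) (added (+ v i) (+ Δ i))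
  ... | false | _ | effect | _ | big with gap (Δb i) (ℕₚ.<-≤-trans (proj₁ (gaps<threshold i)) (big refl))
  ...   | 1≤d , 1≤d+Δb =
    entry-large i k es₁ (+≤+ z≤n) 1≤d
      (subst (λ t → + 1 ≤ (+ vbM i - + vb₁ i) + t) (sym total≡Δb) 1≤d+Δb) norm≤k
    where
      total≡Δb : total i es₁ ≡ Δb i
      total≡Δb = trans (sym (ℤₚ.+-identityˡ _)) effect

  -- Every coordinate admits an exit: by pumping run₂ on C', and by the
  -- largeness of the second pseudo-run outside C'.
  exit : ∀ k (vbM' : Fin d → ℕ) → (∀ i → C' i ≡ false → threshold Nat.≤ vbM' i) →
         ∀ i → norm i es₂ Nat.≤ k → Exit i k ((ι v' ⊕[ C' ] ι vb₁') i) ((ι v' ⊕[ C' ] ι vbM') i) es₂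
  exit k vbM' large' i norm≤k with C' i | crun-safe run₂ i | path-effect run₂ i | Δ'-pos i | large' i
  ... | true  | safe | effect | pos | _ =
    exit-pumped i k es₂ (subst (λ x → Safe i x es₂) start≡ (safe refl))
      (subst (+ 1 ≤_) (sym (trans (cong -_ total≡-Δ') (ℤₚ.neg-involutive (+ Δ' i)))) (+≤+ (pos refl))) (+≤+ z≤n)
    where
      removed : ∀ a t → a - (a + t) ≡ - t
      removed = solve-∀
      restored : ∀ a t → a + t ≡ a - (- t)
      restored = solve-∀
      total≡-Δ' : total i es₂ ≡ - + Δ' i
      total≡-Δ' = trans (effect-of {x = + v' i + + Δ' i} effect) (removed (+ v' i) (+ Δ' i))
      start≡ : + v' i + + Δ' i ≡ + v' i - total i es₂
      start≡ = trans (restored (+ v' i) (+ Δ' i)) (cong (λ t → + v' i - t) (sym total≡-Δ'))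
  ... | false | _ | effect | _ | big with gap (Δb' i) (ℕₚ.<-≤-trans (proj₂ (gaps<threshold i)) (big refl))
  ...   | 1≤d , 1≤d+Δb' =
    exit-large i k es₂ (+≤+ z≤n) 1≤d (subst (+ 1 ≤_) slope≡ 1≤d+Δb') norm≤k
    where
      restored : ∀ a t → a + t ≡ a - (- t)
      restored = solve-∀
      total≡-Δb' : total i es₂ ≡ - Δb' i
      total≡-Δb' = trans (effect-of {x = Δb' i} effect) (ℤₚ.+-identityˡ _)
      slope≡ : (+ vbM' i - + vb₁' i) + Δb' i ≡ (+ vbM' i - + vb₁' i) - total i es₂
      slope≡ = trans (restored (+ vbM' i - + vb₁' i) (Δb' i))
                     (cong (λ t → (+ vbM' i - + vb₁' i) - t) (sym total≡-Δb'))

  -- Given a second pseudo-run B above the threshold, the pumped run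
  -- run₁ᵏ θᵏ A run₂ᵏ (θ the cycle left by removing R from B) is a run
  -- between extrapolated vectors of the required shape.
  pumped-run : (vbM vbM' : Fin d → ℕ) (esB : List (Fin nE)) →
    (∀ i → C i ≡ false → threshold Nat.≤ vbM i) → (∀ i → C' i ≡ false → threshold Nat.≤ vbM' i) →
    PseudoRun q (ι v ⊕[ C ] ι vbM) q' (ι v' ⊕[ C' ] ι vbM') esB →
    (∀ e → threshold Nat.≤ times e esB) →
    Σ (Fin d → ℕ) λ vb → Σ (Fin d → ℕ) λ vb' → Σ (List (Fin nE)) λ es →
      Run q (ι v ⊕[ C ] ι vb) q' (ι v' ⊕[ C' ] ι vb') es
  pumped-run vbM vbM' esB large large' runB often
    with euler (path-walk runB) walk-R (λ e → ℕₚ.<-≤-trans (R<threshold e) (often e))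
  ... | θ , walk-θ , B↭ = (λ i → ∣ start i ∣) , (λ i → ∣ end i ∣) , X , run-of walk-X legs
    where
      k : ℕ
      k = upper (λ i → norm i (es₁ ++ (θ ++ (esA ++ es₂))))

      X : List (Fin nE)
      X = repeat k es₁ ++ (repeat k θ ++ (esA ++ repeat k es₂))

      walk-X : Walk q q' X
      walk-X = repeat-walk k (path-walk run₁) ++ʷ (repeat-walk k walk-θ ++ʷ
                 (path-walk runA ++ʷ repeat-walk k (path-walk run₂)))

      start end : Vecℤ d
      start = extrapolate k (ι v ⊕[ C ] ι vb₁) (ι v ⊕[ C ] ι vbM)
      end   = extrapolate k (ι v' ⊕[ C' ] ι vb₁') (ι v' ⊕[ C' ] ι vbM')

      norm≤k : ∀ i → norm i es₁ Nat.≤ k × norm i θ Nat.≤ k × norm i esA Nat.≤ k × norm i es₂ Nat.≤ k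
      norm≤k i = bound (norm-++ˡ i es₁ _)
               , bound (ℕₚ.≤-trans (norm-++ˡ i θ _) (norm-++ʳ i es₁ _))
               , bound (ℕₚ.≤-trans (norm-++ˡ i esA es₂) (ℕₚ.≤-trans (norm-++ʳ i θ _) (norm-++ʳ i es₁ _)))
               , bound (ℕₚ.≤-trans (norm-++ʳ i esA es₂) (ℕₚ.≤-trans (norm-++ʳ i θ _) (norm-++ʳ i es₁ _)))
        where
          bound : ∀ {n} → n Nat.≤ norm i (es₁ ++ (θ ++ (esA ++ es₂))) → n Nat.≤ k
          bound n≤ = ℕₚ.≤-trans n≤ (≤-upper (λ j → norm j (es₁ ++ (θ ++ (esA ++ es₂)))) i)

      -- B is R plus the closed walk θ, so its effect is the sum of theirs.
      effect-B : ∀ i → (ι v' ⊕[ C' ] ι vbM') i - (ι v ⊕[ C ] ι vbM) i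
                       ≡ total i θ + (total i es₁ + (total i esA + total i es₂))
      effect-B i = begin
        (ι v' ⊕[ C' ] ι vbM') i - (ι v ⊕[ C ] ι vbM) i       ≡⟨ effect-of (path-effect runB i) ⟨
        total i esB                                            ≡⟨ total-↭ i B↭ ⟩
        total i (θ ++ R)                                       ≡⟨ total-++ i θ R ⟩
        total i θ + total i R
          ≡⟨ cong (λ t → total i θ + t) (total-++ i es₁ (esA ++ es₂)) ⟩
        total i θ + (total i es₁ + total i (esA ++ es₂))
          ≡⟨ cong (λ t → total i θ + (total i es₁ + t)) (total-++ i esA es₂) ⟩
        total i θ + (total i es₁ + (total i esA + total i es₂)) ∎
        where open ≡-Reasoning

      leg : ∀ i → Leg i (start i) X (end i)
      leg i with norm≤k i
      ... | n₁ , nθ , nA , n₂ =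
        interpolation i k es₁ θ esA es₂ (entry k vbM large i n₁) (exit k vbM' large' i n₂) nθ nA
          (effect-of (path-effect runA i)) (effect-B i)

      legs : ∀ i → Leg i ((ι v ⊕[ C ] ι (λ j → ∣ start j ∣)) i) X ((ι v' ⊕[ C' ] ι (λ j → ∣ end j ∣)) i)
      legs i = subst₂ (λ x y → Leg i x X y)
                 (sym (extrapolate-⊕ k C v vb₁ vbM i (Leg-start i (leg i))))
                 (sym (extrapolate-⊕ k C' v' vb₁' vbM' i (Leg-end i (leg i))))
                 (leg i)

open import Data.Nat using (_≤_)
open import Data.Integer using (_+_)

proposition2 : ∀ {d : ℕ} → 1 ≤ d → (V : VASS d) → let open VASS V in
    (C C' : Fin d → Bool) (q q' : Q) (v v' : Fin d → ℕ) →
    -- Θ₁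
    (∀ (m : ℕ) → 1 ≤ m →
      Σ (Fin d → ℕ) λ vb → Σ (Fin d → ℕ) λ vb' → Σ (List (Fin nE)) λ es →
        (∀ i → C i ≡ false → m ≤ vb i) × (∀ i → C' i ≡ false → m ≤ vb' i) ×
        PseudoRun q (ι v ⊕[ C ] ι vb) q' (ι v' ⊕[ C' ] ι vb') es ×
        (∀ e → m ≤ times e es)) →
    -- Θ₂
    (Σ (Fin d → ℕ) λ Δ → Σ (Fin d → ℕ) λ Δ' → Σ (Fin d → ℤ) λ Δb → Σ (Fin d → ℤ) λ Δb' → Σ (List (Fin nE)) λ es₁ → Σ (List (Fin nE)) λ es₂ →
        (∀ i → C i ≡ true → 1 ≤ Δ i) × (∀ i → C' i ≡ true → 1 ≤ Δ' i) ×
        CRun C q (ι v ⊕[ C ] 𝟎) q ((λ i → + v i + + Δ i) ⊕[ C ] Δb) es₁ ×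
        CRun C' q' ((λ i → + v' i + + Δ' i) ⊕[ C' ] Δb') q' (ι v' ⊕[ C' ] 𝟎) es₂) →
    -- conclusion
    Σ (Fin d → ℕ) λ vb → Σ (Fin d → ℕ) λ vb' → Σ (List (Fin nE)) λ es → Run q (ι v ⊕[ C ] ι vb) q' (ι v' ⊕[ C' ] ι vb') es
proposition2 _ V C C' q q' v v' Θ₁ (Δ , Δ' , Δb , Δb' , es₁ , es₂ , Δ-pos , Δ'-pos , run₁ , run₂) =
  let vb₁ , vb₁' , esA , _ , _ , runA , _ = Θ₁ 1 (s≤s z≤n)
      open Pumping V C C' q q' v v' Δ Δ' Δb Δb' es₁ es₂ Δ-pos Δ'-pos run₁ run₂ vb₁ vb₁' esA runA
      vbM , vbM' , esB , large , large' , runB , often = Θ₁ threshold (s≤s z≤n)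
  in pumped-run vbM vbM' esB large large' runB often
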